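{- Let $G$ be a connected graph, $n$ a positive integer, and $t$ a positive integer threshold, and let $d=dyn_t(G)$. Then $dyn_t(G\Box K_n)\le td-\left(\dfrac{t^2-3t}{2}+d\right)$.
   Context: $K_n$ is the complete graph on $n$ vertices; $G\Box H$ is the Cartesian product (vertex set $V(G)\times V(H)$, $(u,v)\sim(u',v')$ iff $u=u'$ and $vv'\in E(H)$, or $v=v'$ and $uu'\in E(G)$). Thresholds are assumed not to exceed vertex degrees. For constant threshold $t$, a set $D$ of vertices is a $t$-dynamic monopoly if starting from $D$ and repeatedly adding any vertex having at least $t$ neighbors in the current set eventually yields all vertices; $dyn_t(G)$ is the minimum size of a $t$-dynamic monopoly. -}

module Defs where

open import Data.Nat using (ℕ; zero; suc; _+_; _*_; _≤_; _<_)
open import Data.Fin using (Fin; _≟_; remQuot)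
open import Data.Fin.Subset using (Subset; _∈_; ∣_∣)
open import Data.Vec using (tabulate)
open import Data.Bool using (Bool)
open import Data.Product using (_×_; _,_; Σ; ∃; proj₁; proj₂)
open import Data.Sum using (_⊎_; inj₁; inj₂)
open import Relation.Nullary using (¬_; Dec; yes; no)
open import Relation.Nullary.Decidable using (⌊_⌋; _×-dec_; _⊎-dec_; ¬?)
open import Relation.Binary.PropositionalEquality using (_≡_; refl; sym)

record Graph : Set₁ where
  field
    V       : ℕ
    Adj     : Fin V → Fin V → Set
    adj?    : ∀ u v → Dec (Adj u v)
    symm    : ∀ {u v} → Adj u v → Adj v u
    irrefl  : ∀ {u} → ¬ Adj u u
open Graph public

nbhd : (G : Graph) → Fin (V G) → Subset (V G)
nbhd G v = tabulate (λ u → ⌊ adj? G v u ⌋)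

deg : (G : Graph) → Fin (V G) → ℕ
deg G v = ∣ nbhd G v ∣

data Reach (G : Graph) : Fin (V G) → Fin (V G) → Set where
  here : ∀ {u} → Reach G u u
  step : ∀ {u v w} → Adj G u v → Reach G v w → Reach G u w

Connected : Graph → Set
Connected G = (0 < V G) × (∀ u v → Reach G u v)

K : ℕ → Graph
K n = record
  { V = n
  ; Adj = λ u v → ¬ (u ≡ v)
  ; adj? = λ u v → ¬? (u ≟ v)
  ; symm = λ ne eq → ne (sym eq)
  ; irrefl = λ ne → ne refl
  }

-- Cartesian product G □ H; vertex (u , v) is encoded as combine u v : Fin (V G * V H)
-- and decoded with remQuot.
module _ (G H : Graph) where
  private
    P : Fin (V G * V H) → Fin (V G * V H) → Set
    P x y = let (u , v) = remQuot (V H) x ; (u' , v') = remQuot (V H) y in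
            ((u ≡ u') × Adj H v v') ⊎ ((v ≡ v') × Adj G u u')

    P? : ∀ x y → Dec (P x y)
    P? x y = let (u , v) = remQuot (V H) x ; (u' , v') = remQuot (V H) y in
             ((u ≟ u') ×-dec adj? H v v') ⊎-dec ((v ≟ v') ×-dec adj? G u u')

    Psym : ∀ {x y} → P x y → P y x
    Psym (inj₁ (e , a)) = inj₁ (sym e , symm H a)
    Psym (inj₂ (e , a)) = inj₂ (sym e , symm G a)

    Pirr : ∀ {x} → ¬ P x x
    Pirr (inj₁ (_ , a)) = irrefl H a
    Pirr (inj₂ (_ , a)) = irrefl G a

  _□_ : Graph
  _□_ = record { V = V G * V H ; Adj = P ; adj? = P? ; symm = Psym ; irrefl = Pirr }

data Active (t : ℕ) (G : Graph) (D : Subset (V G)) : Fin (V G) → Set where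
  seed   : ∀ {v} → v ∈ D → Active t G D v
  spread : ∀ {v} (S : Subset (V G)) → t ≤ ∣ S ∣ →
           (∀ u → u ∈ S → Adj G v u) →
           (∀ u → u ∈ S → Active t G D u) → Active t G D v

IsDynMono : ℕ → (G : Graph) → Subset (V G) → Set
IsDynMono t G D = ∀ v → Active t G D v

IsDyn : ℕ → Graph → ℕ → Set
IsDyn t G d = (Σ (Subset (V G)) λ D → IsDynMono t G D × ∣ D ∣ ≡ d)
            × (∀ D → IsDynMono t G D → d ≤ ∣ D ∣)

-- Let u₁, …, u_d enumerate a minimum t-dynamic monopoly D of G and identify the
-- vertices of G □ K n with pairs (u, k). For each k < t − 1 seed the copy G × {k}
-- with (u_i, k), i > k. Copy k is then activated by replaying the process of G:
-- the k seeds u₁, …, u_k left out are compensated by the k neighbours (u, k′),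
-- k′ < k, which are already active. One more seed (y₀, t − 1) finishes the job:
-- every (w, k) with k ≥ t − 1 has the t − 1 active neighbours (w, k′), k′ < t − 1,
-- and a t-th one obtained by following a path from w to y₀. This uses
-- ∑_{k<t−1} (d − k) + 1 seeds, and the closed form of this sum is the bound.

module Submission where

open import Defs
open import Data.Nat
  using (ℕ; zero; suc; _+_; _*_; _∸_; _⊓_; _≤_; _<_; z≤n; s≤s; _≤?_; _<?_; _≤′_; ≤′-refl; ≤′-step)
open import Data.Nat.Properties
  using (≤-refl; ≤-reflexive; ≤-trans; ≤-antisym; ≤-<-trans; <⇒≤; <⇒≱; <⇒≢; ≰⇒>; ≮⇒≥; ≤⇒≤′;
         m<1+n⇒m<n∨m≡n; m⊓n≤m; m≤m+n; n≤1+n; m∸n+n≡m; +-suc; +-identityʳ; +-cancelʳ-≡;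
         +-monoˡ-≤; +-monoʳ-≤; *-monoʳ-≤; module ≤-Reasoning)
open import Data.Nat.Tactic.RingSolver using (solve-∀)
open import Data.Fin using (Fin; zero; suc; toℕ; fromℕ<; inject≤; combine; remQuot; _≟_)
open import Data.Fin.Properties
  using (toℕ<n; toℕ-inject≤; toℕ-fromℕ<; toℕ-injective; inject≤-injective;
         remQuot-combine; combine-remQuot; combine-injectiveˡ; combine-injectiveʳ)
open import Data.Fin.Subset using (Subset; _∈_; _∉_; ∣_∣; _∪_; _─_; ⁅_⁆; ⋃; inside; outside)
open import Data.Fin.Subset.Properties
  using (_∈?_; ∉⊥; ∣⊥∣≡0; ∣⁅x⁆∣≡1; x∈⁅x⁆; x∈⁅y⁆⇒x≡y; x≢y⇒x∉⁅y⁆; x∈p∪q⁺; x∈p∪q⁻;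
         x∈p∧x∉q⇒x∈p─q; p─q⊆p; x∈p⇒∣p-x∣<∣p∣; p⊆q⇒∣p∣≤∣q∣)
open import Data.Vec using ([]; _∷_; there)
open import Data.Vec.Properties using ([]=⇒lookup; lookup∘tabulate)
open import Data.List using (List; []; _∷_; _++_; map; filter; length; allFin; take; drop)
open import Data.List.Properties
  using (length-++; length-map; length-tabulate; length-take; length-drop; take++drop≡id)
open import Data.List.Membership.Propositional using () renaming (_∈_ to _∈ᴸ_)
open import Data.List.Membership.Propositional.Properties
  using (∈-filter⁺; ∈-filter⁻; ∈-allFin; ∈-map⁺; ∈-map⁻; ∈-++⁺ˡ; ∈-++⁺ʳ; ∈-++⁻)
import Data.List.Relation.Unary.All as All
open import Data.List.Relation.Unary.Any using (here; there)
open import Data.List.Relation.Unary.AllPairs using ([]; _∷_)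
open import Data.List.Relation.Unary.Unique.Propositional using (Unique)
open import Data.List.Relation.Unary.Unique.Propositional.Properties
  using (filter⁺; allFin⁺; map⁺; ++⁺)
open import Data.Sum using (_⊎_; inj₁; inj₂)
open import Data.Product using (Σ; _×_; _,_; proj₁; proj₂)
open import Data.Empty using (⊥-elim)
open import Function.Definitions using (Injective)
open import Relation.Nullary using (¬_; yes; no)
open import Relation.Binary.PropositionalEquality
  using (_≡_; refl; sym; trans; cong; cong₂; subst; subst₂; module ≡-Reasoning)

private variable
  m : ℕ
  p q : Subset m
  x y : Fin m
  xs : List (Fin m)

∣p∪q∣≤∣p∣+∣q∣ : (p q : Subset m) → ∣ p ∪ q ∣ ≤ ∣ p ∣ + ∣ q ∣
∣p∪q∣≤∣p∣+∣q∣ []            []            = z≤n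
∣p∪q∣≤∣p∣+∣q∣ (inside  ∷ p) (inside  ∷ q) =
  s≤s (≤-trans (∣p∪q∣≤∣p∣+∣q∣ p q) (≤-trans (n≤1+n _) (≤-reflexive (sym (+-suc _ _)))))
∣p∪q∣≤∣p∣+∣q∣ (inside  ∷ p) (outside ∷ q) = s≤s (∣p∪q∣≤∣p∣+∣q∣ p q)
∣p∪q∣≤∣p∣+∣q∣ (outside ∷ p) (inside  ∷ q) =
  ≤-trans (s≤s (∣p∪q∣≤∣p∣+∣q∣ p q)) (≤-reflexive (sym (+-suc _ _)))
∣p∪q∣≤∣p∣+∣q∣ (outside ∷ p) (outside ∷ q) = ∣p∪q∣≤∣p∣+∣q∣ p q

x∈p─q⇒x∉q : (p q : Subset m) → x ∈ p ─ q → x ∉ q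
x∈p─q⇒x∉q (_ ∷ p) (inside  ∷ q) (there x∈) (there x∈q) = x∈p─q⇒x∉q p q x∈ x∈q
x∈p─q⇒x∉q (_ ∷ p) (outside ∷ q) (there x∈) (there x∈q) = x∈p─q⇒x∉q p q x∈ x∈q

∣p∣≤∣p─q∣+∣q∣ : (p q : Subset m) → ∣ p ∣ ≤ ∣ p ─ q ∣ + ∣ q ∣
∣p∣≤∣p─q∣+∣q∣ p q = ≤-trans (p⊆q⇒∣p∣≤∣q∣ split) (∣p∪q∣≤∣p∣+∣q∣ (p ─ q) q)
  where
  split : ∀ {x} → x ∈ p → x ∈ (p ─ q) ∪ q
  split {x} x∈p with x ∈? q
  ... | yes x∈q = x∈p∪q⁺ (inj₂ x∈q)
  ... | no  x∉q = x∈p∪q⁺ (inj₁ (x∈p∧x∉q⇒x∈p─q x∈p x∉q))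

fromList : List (Fin m) → Subset m
fromList xs = ⋃ (map ⁅_⁆ xs)

∈-fromList⁺ : x ∈ᴸ xs → x ∈ fromList xs
∈-fromList⁺ (here refl) = x∈p∪q⁺ (inj₁ (x∈⁅x⁆ _))
∈-fromList⁺ (there x∈) = x∈p∪q⁺ (inj₂ (∈-fromList⁺ x∈))

∈-fromList⁻ : (xs : List (Fin m)) → x ∈ fromList xs → x ∈ᴸ xs
∈-fromList⁻ []       x∈ = ⊥-elim (∉⊥ x∈)
∈-fromList⁻ (y ∷ ys) x∈ with x∈p∪q⁻ ⁅ y ⁆ (fromList ys) x∈
... | inj₁ x∈⁅y⁆ = here (x∈⁅y⁆⇒x≡y y x∈⁅y⁆)
... | inj₂ x∈ys  = there (∈-fromList⁻ ys x∈ys)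

∣fromList∣≤length : (xs : List (Fin m)) → ∣ fromList xs ∣ ≤ length xs
∣fromList∣≤length {m} []       = ≤-reflexive (∣⊥∣≡0 m)
∣fromList∣≤length     (x ∷ xs) =
  ≤-trans (∣p∪q∣≤∣p∣+∣q∣ ⁅ x ⁆ (fromList xs))
          (≤-trans (+-monoˡ-≤ _ (≤-reflexive (∣⁅x⁆∣≡1 x))) (s≤s (∣fromList∣≤length xs)))

Unique∧⊆⇒length≤∣p∣ : {p : Subset m} → Unique xs → (∀ {x} → x ∈ᴸ xs → x ∈ p) → length xs ≤ ∣ p ∣
Unique∧⊆⇒length≤∣p∣ {xs = []}     _          _  = z≤n
Unique∧⊆⇒length≤∣p∣ {xs = x ∷ xs} {p} (x∉xs ∷ u) xs⊆p =
  ≤-trans (s≤s (Unique∧⊆⇒length≤∣p∣ u xs⊆p-x)) (x∈p⇒∣p-x∣<∣p∣ (xs⊆p (here refl)))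
  where
  xs⊆p-x : ∀ {y} → y ∈ᴸ xs → y ∈ p ─ ⁅ x ⁆
  xs⊆p-x y∈ = x∈p∧x∉q⇒x∈p─q (xs⊆p (there y∈)) (x≢y⇒x∉⁅y⁆ (λ y≡x → All.lookup x∉xs y∈ (sym y≡x)))

elements : Subset m → List (Fin m)
elements p = filter (_∈? p) (allFin _)

∈-elements⁺ : x ∈ p → x ∈ᴸ elements p
∈-elements⁺ {p = p} x∈p = ∈-filter⁺ (_∈? p) (∈-allFin _) x∈p

∈-elements⁻ : x ∈ᴸ elements p → x ∈ p
∈-elements⁻ {p = p} x∈ = proj₂ (∈-filter⁻ (_∈? p) {xs = allFin _} x∈)

elements-unique : (p : Subset m) → Unique (elements p)
elements-unique p = filter⁺ (_∈? p) (allFin⁺ _)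

length-elements : (p : Subset m) → length (elements p) ≡ ∣ p ∣
length-elements p = ≤-antisym
  (Unique∧⊆⇒length≤∣p∣ (elements-unique p) (∈-elements⁻ {p = p}))
  (≤-trans (p⊆q⇒∣p∣≤∣q∣ (λ x∈p → ∈-fromList⁺ (∈-elements⁺ {p = p} x∈p)))
           (∣fromList∣≤length (elements p)))

nbhd⇒Adj : (G : Graph) {v u : Fin (V G)} → u ∈ nbhd G v → Adj G v u
nbhd⇒Adj G {v} {u} u∈ with adj? G v u | trans (sym (lookup∘tabulate _ u)) ([]=⇒lookup u∈)
... | yes v~u | _ = v~u
... | no  _   | ()

module _ {t : ℕ} {G : Graph} {D : Subset (V G)} where

  spread-unique : ∀ {v} (xs : List (Fin (V G))) → Unique xs → t ≤ length xs →
                  (∀ {u} → u ∈ᴸ xs → Adj G v u) → (∀ {u} → u ∈ᴸ xs → Active t G D u) →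
                  Active t G D v
  spread-unique xs xs-unique t≤∣xs∣ adj act =
    spread (fromList xs) (≤-trans t≤∣xs∣ (Unique∧⊆⇒length≤∣p∣ xs-unique ∈-fromList⁺))
           (λ u u∈ → adj (∈-fromList⁻ xs u∈)) (λ u u∈ → act (∈-fromList⁻ xs u∈))

  ∣D∣<t⇒Active⇒∈D : ∣ D ∣ < t → ∀ {v} → Active t G D v → v ∈ D
  ∣D∣<t⇒Active⇒∈D ∣D∣<t (seed v∈D)            = v∈D
  ∣D∣<t⇒Active⇒∈D ∣D∣<t (spread S t≤∣S∣ _ act) = ⊥-elim (<⇒≱ ∣D∣<t
    (≤-trans t≤∣S∣ (p⊆q⇒∣p∣≤∣q∣ (λ {u} u∈S → ∣D∣<t⇒Active⇒∈D ∣D∣<t (act u u∈S)))))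

  dynMono⇒t≤∣D∣ : IsDynMono t G D → ∀ v → t ≤ deg G v → t ≤ ∣ D ∣
  dynMono⇒t≤∣D∣ mono v t≤deg with t ≤? ∣ D ∣
  ... | yes t≤∣D∣ = t≤∣D∣
  ... | no  t≰∣D∣ =
    ≤-trans t≤deg (p⊆q⇒∣p∣≤∣q∣ {p = nbhd G v} (λ {u} _ → ∣D∣<t⇒Active⇒∈D (≰⇒> t≰∣D∣) (mono u)))

-- The |R| extra neighbours of φ v make up for the seeds of R that are not copied.
module Lift
  {t : ℕ} {G H : Graph} {D : Subset (V G)} {E : Subset (V H)} (D-dynMono : IsDynMono t G D)
  (φ : Fin (V G) → Fin (V H)) (φ-injective : Injective _≡_ _≡_ φ)
  (φ-adj : ∀ {u w} → Adj G u w → Adj H (φ u) (φ w))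
  (R : Subset (V G)) (R-deg : ∀ {v} → v ∈ R → t ≤ deg G v)
  (extra : Fin (V G) → List (Fin (V H)))
  (extra-unique : ∀ v → Unique (extra v))
  (extra-size : ∀ v → ∣ R ∣ ≤ length (extra v))
  (extra-adj : ∀ v {x} → x ∈ᴸ extra v → Adj H (φ v) x)
  (extra-active : ∀ v {x} → x ∈ᴸ extra v → Active t H E x)
  (extra-∉image : ∀ v u → ¬ φ u ∈ᴸ extra v)
  (seeds-active : ∀ {v} → v ∈ D → v ∉ R → Active t H E (φ v))
  where

  spread-φ : ∀ v (S : Subset (V G)) → t ≤ ∣ S ∣ → (∀ u → u ∈ S → Adj G v u) →
             (∀ {u} → u ∈ S ─ R → Active t H E (φ u)) → Active t H E (φ v)
  spread-φ v S t≤∣S∣ adj act =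
    spread-unique candidates unique t≤∣candidates∣ candidates-adj candidates-active
    where
    inner candidates : List (Fin (V H))
    inner      = map φ (elements (S ─ R))
    candidates = inner ++ extra v

    unique : Unique candidates
    unique = ++⁺ (map⁺ φ-injective (elements-unique (S ─ R))) (extra-unique v) disjoint
      where
      disjoint : ∀ {x} → ¬ (x ∈ᴸ inner × x ∈ᴸ extra v)
      disjoint (x∈inner , x∈extra) with ∈-map⁻ φ x∈inner
      ... | u , _ , refl = extra-∉image v u x∈extra

    t≤∣candidates∣ : t ≤ length candidates
    t≤∣candidates∣ = begin
      t                                          ≤⟨ t≤∣S∣ ⟩
      ∣ S ∣                                      ≤⟨ ∣p∣≤∣p─q∣+∣q∣ S R ⟩
      ∣ S ─ R ∣ + ∣ R ∣                          ≤⟨ +-monoʳ-≤ _ (extra-size v) ⟩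
      ∣ S ─ R ∣ + length (extra v)               ≡⟨ cong (_+ _) (sym ∣inner∣) ⟩
      length inner + length (extra v)            ≡⟨ sym (length-++ inner) ⟩
      length candidates                          ∎
      where
      open ≤-Reasoning
      ∣inner∣ : length inner ≡ ∣ S ─ R ∣
      ∣inner∣ = trans (length-map φ (elements (S ─ R))) (length-elements (S ─ R))

    candidates-adj : ∀ {x} → x ∈ᴸ candidates → Adj H (φ v) x
    candidates-adj x∈ with ∈-++⁻ inner x∈
    ... | inj₂ x∈extra = extra-adj v x∈extra
    ... | inj₁ x∈inner with ∈-map⁻ φ x∈inner
    ...   | u , u∈ , refl = φ-adj (adj u (p─q⊆p S R (∈-elements⁻ u∈)))

    candidates-active : ∀ {x} → x ∈ᴸ candidates → Active t H E x
    candidates-active x∈ with ∈-++⁻ inner x∈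
    ... | inj₂ x∈extra = extra-active v x∈extra
    ... | inj₁ x∈inner with ∈-map⁻ φ x∈inner
    ...   | u , u∈ , refl = act (∈-elements⁻ u∈)

  Active-φ : ∀ {v} → Active t G D v → v ∉ R → Active t H E (φ v)
  Active-φ (seed v∈D)              v∉R = seeds-active v∈D v∉R
  Active-φ (spread S t≤∣S∣ adj act) _  = spread-φ _ S t≤∣S∣ adj
    (λ {u} u∈S─R → Active-φ (act u (p─q⊆p S R u∈S─R)) (x∈p─q⇒x∉q S R u∈S─R))

  φ-active : ∀ v → Active t H E (φ v)
  φ-active v with v ∈? R
  ... | no  v∉R = Active-φ (D-dynMono v) v∉R
  ... | yes v∈R = spread-φ v (nbhd G v) (R-deg v∈R) (λ u → nbhd⇒Adj G)
    (λ {u} u∈ → Active-φ (D-dynMono u) (x∈p─q⇒x∉q (nbhd G v) R u∈))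

module _ {G : Graph} {n : ℕ} where
  private
    -- Adj (G □ K n) x y unfolds to Adj-pairs (remQuot n x) (remQuot n y).
    Adj-pairs : Fin (V G) × Fin n → Fin (V G) × Fin n → Set
    Adj-pairs a b = (proj₁ a ≡ proj₁ b × Adj (K n) (proj₂ a) (proj₂ b))
                  ⊎ (proj₂ a ≡ proj₂ b × Adj G (proj₁ a) (proj₁ b))

    □-adj : ∀ {u j u' j'} → Adj-pairs (u , j) (u' , j') →
            Adj (G □ K n) (combine u j) (combine u' j')
    □-adj {u} {j} {u'} {j'} =
      subst₂ Adj-pairs (sym (remQuot-combine {k = n} u j)) (sym (remQuot-combine {k = n} u' j'))

  □-adj-G : ∀ {u u' : Fin (V G)} j → Adj G u u' → Adj (G □ K n) (combine u j) (combine u' j)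
  □-adj-G j u~u' = □-adj (inj₂ (refl , u~u'))

  □-adj-K : ∀ (u : Fin (V G)) {j j'} → ¬ j ≡ j' → Adj (G □ K n) (combine u j) (combine u j')
  □-adj-K u j≢j' = □-adj (inj₁ (refl , j≢j'))

below : ∀ {n} (j : ℕ) → j ≤ n → List (Fin n)
below j j≤n = map (λ i → inject≤ i j≤n) (allFin j)

length-below : ∀ {n} j (j≤n : j ≤ n) → length (below j j≤n) ≡ j
length-below j j≤n = trans (length-map _ (allFin j)) (length-tabulate {n = j} (λ i → i))

below-unique : ∀ {n} j (j≤n : j ≤ n) → Unique (below j j≤n)
below-unique j j≤n = map⁺ (inject≤-injective j≤n j≤n _ _) (allFin⁺ j)

∈-below⁻ : ∀ {n j} (j≤n : j ≤ n) {k} → k ∈ᴸ below j j≤n → toℕ k < j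
∈-below⁻ {j = j} j≤n k∈ with ∈-map⁻ (λ i → inject≤ i j≤n) k∈
... | i , _ , refl = subst (_< j) (sym (toℕ-inject≤ i j≤n)) (toℕ<n i)

∈-drop : ∀ {A : Set} {x : A} j xs → x ∈ᴸ xs → ¬ x ∈ᴸ take j xs → x ∈ᴸ drop j xs
∈-drop j xs x∈xs x∉take with ∈-++⁻ (take j xs) (subst (_ ∈ᴸ_) (sym (take++drop≡id j xs)) x∈xs)
... | inj₁ x∈take = ⊥-elim (x∉take x∈take)
... | inj₂ x∈drop = x∈drop

descendingSum : ℕ → ℕ → ℕ
descendingSum d zero    = 0
descendingSum d (suc a) = descendingSum d a + (d ∸ a)

descendingSum-mono : ∀ d {a b} → a ≤ b → descendingSum d a ≤ descendingSum d b
descendingSum-mono d a≤b = mono′ (≤⇒≤′ a≤b)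
  where
  mono′ : ∀ {a b} → a ≤′ b → descendingSum d a ≤ descendingSum d b
  mono′ ≤′-refl         = ≤-refl
  mono′ (≤′-step a≤′b) = ≤-trans (mono′ a≤′b) (m≤m+n _ _)

descendingSum-closedForm : ∀ {d} a → a ≤ d → 2 * descendingSum d a + a * a ≡ 2 * (a * d) + a
descendingSum-closedForm zero _ = refl
descendingSum-closedForm {d} (suc a) a<d = begin
  2 * (descendingSum d a + (d ∸ a)) + suc a * suc a   ≡⟨ expand (descendingSum d a) a (d ∸ a) ⟩
  (2 * descendingSum d a + a * a) + 2 * ((d ∸ a) + a) + 1
    ≡⟨ cong₂ (λ x y → x + 2 * y + 1) (descendingSum-closedForm a (<⇒≤ a<d)) (m∸n+n≡m (<⇒≤ a<d)) ⟩
  2 * (a * d) + a + 2 * d + 1                          ≡⟨ collect a d ⟩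
  2 * (suc a * d) + suc a                              ∎
  where
  open ≡-Reasoning
  expand : ∀ F a e → 2 * (F + e) + suc a * suc a ≡ (2 * F + a * a) + 2 * (e + a) + 1
  expand = solve-∀
  collect : ∀ a d → 2 * (a * d) + a + 2 * d + 1 ≡ 2 * (suc a * d) + suc a
  collect = solve-∀

bound-from-descendingSum : ∀ {p d} d' → p ≤ d → d' ≤ descendingSum d p + 1 →
                           2 * d' + suc p * suc p + 2 * d ≤ 2 * (suc p * d) + 3 * suc p
bound-from-descendingSum {p} {d} d' p≤d d'≤ = begin
  2 * d' + suc p * suc p + 2 * d
    ≤⟨ +-monoˡ-≤ (2 * d) (+-monoˡ-≤ (suc p * suc p) (*-monoʳ-≤ 2 d'≤)) ⟩
  2 * (F + 1) + suc p * suc p + 2 * d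
    ≡⟨ +-cancelʳ-≡ (p * p) _ _ equation ⟩
  2 * (suc p * d) + 3 * suc p
  ∎
  where
  open ≤-Reasoning
  F : ℕ
  F = descendingSum d p

  regroup : ∀ F p d → 2 * (F + 1) + suc p * suc p + 2 * d + p * p
                    ≡ (2 * F + p * p) + (suc p * suc p + 2 + 2 * d)
  regroup = solve-∀

  collect : ∀ p d → (2 * (p * d) + p) + (suc p * suc p + 2 + 2 * d)
                  ≡ 2 * (suc p * d) + 3 * suc p + p * p
  collect = solve-∀

  equation : 2 * (F + 1) + suc p * suc p + 2 * d + p * p ≡ 2 * (suc p * d) + 3 * suc p + p * p
  equation = trans (regroup F p d)
    (trans (cong (_+ (suc p * suc p + 2 + 2 * d)) (descendingSum-closedForm p p≤d)) (collect p d))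

module ProductMonopoly (G : Graph) (n t : ℕ) (deg≥t : ∀ v → t ≤ deg G v)
                       (D : Subset (V G)) (D-dynMono : IsDynMono t G D) where

  H : Graph
  H = G □ K n

  ⟨_,_⟩ : Fin (V G) → Fin n → Fin (V H)
  ⟨ u , j ⟩ = combine u j

  L : List (Fin (V G))
  L = elements D

  layers : (a : ℕ) → a ≤ n → List (Fin (V H))
  layers zero    _   = []
  layers (suc a) a<n = layers a (<⇒≤ a<n) ++ map (λ u → ⟨ u , fromℕ< a<n ⟩) (drop a L)

  length-layers : ∀ a (a≤n : a ≤ n) → length (layers a a≤n) ≡ descendingSum ∣ D ∣ a
  length-layers zero    _   = refl
  length-layers (suc a) a<n = begin
    length (layers a _ ++ map _ (drop a L))             ≡⟨ length-++ (layers a _) ⟩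
    length (layers a _) + length (map _ (drop a L))     ≡⟨ cong₂ _+_ (length-layers a _) ∣layer∣ ⟩
    descendingSum ∣ D ∣ a + (∣ D ∣ ∸ a)                 ∎
    where
    open ≡-Reasoning
    ∣layer∣ : length (map (λ u → ⟨ u , fromℕ< a<n ⟩) (drop a L)) ≡ ∣ D ∣ ∸ a
    ∣layer∣ = trans (length-map _ (drop a L))
                (trans (length-drop a L) (cong (_∸ a) (length-elements D)))

  ∈-layers⁺ : ∀ a (a≤n : a ≤ n) {k u} → toℕ k < a → u ∈ᴸ drop (toℕ k) L →
              ⟨ u , k ⟩ ∈ᴸ layers a a≤n
  ∈-layers⁺ (suc a) a<n {k} k<1+a u∈ with m<1+n⇒m<n∨m≡n k<1+a
  ... | inj₁ k<a  = ∈-++⁺ˡ (∈-layers⁺ a (<⇒≤ a<n) k<a u∈)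
  ... | inj₂ refl = ∈-++⁺ʳ (layers a _)
    (subst (λ k' → ⟨ _ , k ⟩ ∈ᴸ map (λ u → ⟨ u , k' ⟩) (drop a L)) k≡a (∈-map⁺ _ u∈))
    where
    k≡a : k ≡ fromℕ< a<n
    k≡a = toℕ-injective (sym (toℕ-fromℕ< a<n))

  module Layered (a : ℕ) (a≤n : a ≤ n) (extraSeeds : List (Fin (V H))) where

    seeds : Subset (V H)
    seeds = fromList (layers a a≤n ++ extraSeeds)

    Act : Fin (V H) → Set
    Act = Active t H seeds

    ∣seeds∣≤ : ∣ seeds ∣ ≤ descendingSum ∣ D ∣ a + length extraSeeds
    ∣seeds∣≤ = ≤-trans (∣fromList∣≤length (layers a a≤n ++ extraSeeds))
      (≤-reflexive (trans (length-++ (layers a a≤n)) (cong (_+ _) (length-layers a a≤n))))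

    layer-active : ∀ k → toℕ k < a → (∀ {k'} → toℕ k' < toℕ k → ∀ u → Act ⟨ u , k' ⟩) →
                   ∀ u → Act ⟨ u , k ⟩
    layer-active k k<a lower-active = Lift.φ-active D-dynMono
        (λ u → ⟨ u , k ⟩) (λ {u} {u'} → combine-injectiveˡ u k u' k) (□-adj-G {G = G} {n = n} k)
        R (λ {v} _ → deg≥t v)
        extra (λ v → map⁺ (combine-injectiveʳ v _ v _) (below-unique j j≤n)) extra-size
        extra-adj extra-active extra-∉image seed-active
      where
      j : ℕ
      j = toℕ k

      j≤n : j ≤ n
      j≤n = <⇒≤ (toℕ<n k)

      R : Subset (V G)
      R = fromList (take j L)

      extra : Fin (V G) → List (Fin (V H))
      extra v = map ⟨ v ,_⟩ (below j j≤n)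

      extra-size : ∀ v → ∣ R ∣ ≤ length (extra v)
      extra-size v = begin
        ∣ R ∣              ≤⟨ ∣fromList∣≤length (take j L) ⟩
        length (take j L)  ≡⟨ length-take j L ⟩
        j ⊓ length L       ≤⟨ m⊓n≤m j _ ⟩
        j                  ≡⟨ sym (trans (length-map ⟨ v ,_⟩ (below j j≤n)) (length-below j j≤n)) ⟩
        length (extra v)   ∎
        where open ≤-Reasoning

      extra-adj : ∀ v {x} → x ∈ᴸ extra v → Adj H ⟨ v , k ⟩ x
      extra-adj v x∈ with ∈-map⁻ ⟨ v ,_⟩ x∈
      ... | k' , k'∈ , refl =
        □-adj-K {G = G} v (λ k≡k' → <⇒≢ (∈-below⁻ j≤n k'∈) (cong toℕ (sym k≡k')))

      extra-active : ∀ v {x} → x ∈ᴸ extra v → Act x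
      extra-active v x∈ with ∈-map⁻ ⟨ v ,_⟩ x∈
      ... | k' , k'∈ , refl = lower-active (∈-below⁻ j≤n k'∈) v

      extra-∉image : ∀ v u → ¬ ⟨ u , k ⟩ ∈ᴸ extra v
      extra-∉image v u x∈ with ∈-map⁻ ⟨ v ,_⟩ x∈
      ... | k' , k'∈ , eq = <⇒≢ (∈-below⁻ j≤n k'∈) (cong toℕ (sym (combine-injectiveʳ u k v k' eq)))

      seed-active : ∀ {v} → v ∈ D → v ∉ R → Act ⟨ v , k ⟩
      seed-active {v} v∈D v∉R = seed (∈-fromList⁺ (∈-++⁺ˡ (∈-layers⁺ a a≤n k<a
        (∈-drop j L (∈-elements⁺ v∈D) (λ v∈take → v∉R (∈-fromList⁺ v∈take))))))

    lower-layers-active : ∀ k → toℕ k < a → ∀ u → Act ⟨ u , k ⟩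
    lower-layers-active k k<a = layers-below-active (suc (toℕ k)) ≤-refl k<a
      where
      layers-below-active : ∀ {k} b → toℕ k < b → toℕ k < a → ∀ u → Act ⟨ u , k ⟩
      layers-below-active {k} (suc b) k<1+b k<a with m<1+n⇒m<n∨m≡n k<1+b
      ... | inj₁ k<b  = layers-below-active b k<b k<a
      ... | inj₂ refl = layer-active k k<a
        (λ k'<k → layers-below-active b k'<k (≤-<-trans (<⇒≤ k'<k) k<a))

    dynMono : (∀ u k → Act ⟨ u , k ⟩) → IsDynMono t H seeds
    dynMono all-active x =
      subst Act (combine-remQuot {V G} n x)
            (all-active (proj₁ (remQuot {V G} n x)) (proj₂ (remQuot {V G} n x)))

  module Apex (p : ℕ) (p<n : p < n) (t≤1+p : t ≤ suc p) (y₀ : Fin (V G)) where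

    p≤n : p ≤ n
    p≤n = <⇒≤ p<n

    apex : Fin n
    apex = fromℕ< p<n

    open Layered p p≤n (⟨ y₀ , apex ⟩ ∷ []) public

    column : Fin (V G) → List (Fin (V H))
    column w = map ⟨ w ,_⟩ (below p p≤n)

    ∈-column⁻ : ∀ {u v k} → ⟨ v , k ⟩ ∈ᴸ column u → v ≡ u × toℕ k < p
    ∈-column⁻ {u} {v} {k} x∈ with ∈-map⁻ ⟨ u ,_⟩ x∈
    ... | k' , k'∈ , eq =
      combine-injectiveˡ v k u k' eq ,
      subst (λ i → toℕ i < p) (sym (combine-injectiveʳ v k u k' eq)) (∈-below⁻ p≤n k'∈)

    apex-active : Act ⟨ y₀ , apex ⟩
    apex-active = seed (∈-fromList⁺ (∈-++⁺ʳ (layers p p≤n) (here refl)))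

    active-via : ∀ {w k x} → p ≤ toℕ k → Adj H ⟨ w , k ⟩ x → Act x → ¬ x ∈ᴸ column w →
                 Act ⟨ w , k ⟩
    active-via {w} {k} {x} p≤k k~x x-active x∉ = spread-unique (x ∷ column w) unique t≤ adj act
      where
      unique : Unique (x ∷ column w)
      unique = All.tabulate (λ y∈ x≡y → x∉ (subst (_∈ᴸ column w) (sym x≡y) y∈))
             ∷ map⁺ (combine-injectiveʳ w _ w _) (below-unique p p≤n)

      t≤ : t ≤ length (x ∷ column w)
      t≤ = ≤-trans t≤1+p (s≤s (≤-reflexive (sym
             (trans (length-map ⟨ w ,_⟩ (below p p≤n)) (length-below p p≤n)))))

      adj : ∀ {y} → y ∈ᴸ x ∷ column w → Adj H ⟨ w , k ⟩ y
      adj (here refl) = k~x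
      adj (there y∈) with ∈-map⁻ ⟨ w ,_⟩ y∈
      ... | k' , k'∈ , refl =
        □-adj-K {G = G} w (λ k≡k' → <⇒≱ (∈-below⁻ p≤n k'∈) (subst (λ i → p ≤ toℕ i) k≡k' p≤k))

      act : ∀ {y} → y ∈ᴸ x ∷ column w → Act y
      act (here refl) = x-active
      act (there y∈) with ∈-map⁻ ⟨ w ,_⟩ y∈
      ... | k' , k'∈ , refl = lower-layers-active k' (∈-below⁻ p≤n k'∈) w

    upper-active : ∀ {u} → Reach G u y₀ → ∀ k → p ≤ toℕ k → Act ⟨ u , k ⟩
    upper-active here k p≤k with k ≟ apex
    ... | yes refl   = apex-active
    ... | no  k≢apex = active-via p≤k (□-adj-K {G = G} y₀ k≢apex) apex-active
      (λ x∈ → <⇒≢ (proj₂ (∈-column⁻ x∈)) (toℕ-fromℕ< p<n))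
    upper-active (step u~v v⇝y₀) k p≤k = active-via p≤k (□-adj-G {G = G} {n = n} k u~v)
      (upper-active v⇝y₀ k p≤k) (λ x∈ → irrefl G (subst (Adj G _) (proj₁ (∈-column⁻ x∈)) u~v))

    all-active : (∀ u → Reach G u y₀) → ∀ u k → Act ⟨ u , k ⟩
    all-active reach u k with toℕ k <? p
    ... | yes k<p = lower-layers-active k k<p u
    ... | no  k≮p = upper-active (reach u) k (≮⇒≥ k≮p)

  small-dynMono : ∀ p → t ≤ suc p → (y₀ : Fin (V G)) → (∀ u → Reach G u y₀) →
                  Σ (Subset (V H)) λ S → IsDynMono t H S × ∣ S ∣ ≤ descendingSum ∣ D ∣ p + 1
  small-dynMono p t≤1+p y₀ reach with p <? n
  ... | yes p<n = seeds , dynMono (all-active reach) , ∣seeds∣≤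
    where open Apex p p<n t≤1+p y₀
  -- If n ≤ t − 1, the n layers alone already activate everything.
  ... | no  p≮n = seeds , dynMono (λ u k → lower-layers-active k (toℕ<n k) u) , ∣S∣≤
    where
    open Layered n ≤-refl []
    ∣S∣≤ : ∣ seeds ∣ ≤ descendingSum ∣ D ∣ p + 1
    ∣S∣≤ = ≤-trans ∣seeds∣≤ (≤-trans (≤-reflexive (+-identityʳ _))
             (≤-trans (descendingSum-mono ∣ D ∣ (≮⇒≥ p≮n)) (m≤m+n _ 1)))

theorem10 : (G : Graph) (n t d d' : ℕ) → Connected G → 0 < n → 0 < t →
    (∀ (v : Fin (V G)) → t ≤ deg G v) →
    IsDyn t G d → IsDyn t (G □ K n) d' →
    2 * d' + t * t + 2 * d ≤ 2 * (t * d) + 3 * t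
theorem10 G n zero    d d' _ _ () _ _ _
theorem10 G n (suc p) d d' (0<V , connected) _ _ deg≥t ((D , D-dynMono , refl) , _) (_ , minimal) =
  let S , S-dynMono , ∣S∣≤ = small-dynMono p ≤-refl y₀ (λ u → connected u y₀)
  in  bound-from-descendingSum d' p≤∣D∣ (≤-trans (minimal S S-dynMono) ∣S∣≤)
  where
  open ProductMonopoly G n (suc p) deg≥t D D-dynMono using (small-dynMono)

  y₀ : Fin (V G)
  y₀ = fromℕ< 0<V

  p≤∣D∣ : p ≤ ∣ D ∣
  p≤∣D∣ = <⇒≤ (dynMono⇒t≤∣D∣ D-dynMono y₀ (deg≥t y₀))
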